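{- Let $n,k,t,r$ be positive integers. Then \[\left[{n\atop k/t}\right]_r=(t+k-1)_{k-1}\left[{n\atop t+k-1}\right]_r,\] where $(x)_m=x(x-1)\cdots(x-m+1)$.
   Context: The $r$-Stirling number of the first kind $\left[{n\atop m}\right]_r$ is the number of permutations of $[n]=\{1,\ldots,n\}$ with exactly $m$ cycles such that the elements $1,2,\ldots,r$ lie in distinct cycles. An $r$-mixed coloured permutation (with parameters $k\ge1$, $t\ge0$) is a permutation of $[n]$ in which $1,\ldots,r$ lie in distinct cycles, together with a colouring of its cycles by colours from $\{1,\ldots,k\}$ such that exactly $t$ cycles receive colour $1$ (the special colour) and each of the colours $2,\ldots,k$ is used on exactly one cycle; $\left[{n\atop k/t}\right]_r$ denotes their number. -}

module Defs where

open import Data.Nat using (ℕ; zero; suc; _*_; _∸_; _<_; _≟_)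
open import Data.Nat.Properties using (_<?_)
open import Data.Fin using (Fin; zero; suc; toℕ)
import Data.Fin.Properties as FinP
open import Data.Vec using (Vec; []; _∷_; lookup)
open import Data.List using (List; [_]; map; concatMap; filter; length; allFin)
open import Data.Product using (Σ; ∃; _×_; _,_; proj₁; proj₂)
open import Relation.Nullary using (¬_; Dec)
open import Relation.Nullary.Decidable using (_×-dec_; _→-dec_; ¬?)
open import Relation.Binary.PropositionalEquality using (_≡_)

allVecs : (n k : ℕ) → List (Vec (Fin k) n)
allVecs zero    k = [ [] ]
allVecs (suc n) k = concatMap (λ x → map (x ∷_) (allVecs n k)) (allFin k)

-- a candidate permutation of [n] (elements 1..n encoded as Fin n, i ↦ i+1)
Fun : ℕ → Set
Fun n = Vec (Fin n) n

IsPerm : ∀ {n} → Fun n → Set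
IsPerm σ = ∀ i j → lookup σ i ≡ lookup σ j → i ≡ j

isPerm? : ∀ {n} (σ : Fun n) → Dec (IsPerm σ)
isPerm? σ = FinP.all? λ i → FinP.all? λ j → (lookup σ i FinP.≟ lookup σ j) →-dec (i FinP.≟ j)

iter : ∀ {n} → Fun n → ℕ → Fin n → Fin n
iter σ zero    i = i
iter σ (suc m) i = lookup σ (iter σ m i)

SameCycle : ∀ {n} → Fun n → Fin n → Fin n → Set
SameCycle {n} σ i j = ∃ λ (m : Fin n) → iter σ (toℕ m) i ≡ j

sameCycle? : ∀ {n} (σ : Fun n) i j → Dec (SameCycle σ i j)
sameCycle? σ i j = FinP.any? λ m → iter σ (toℕ m) i FinP.≟ j

IsLeader : ∀ {n} → Fun n → Fin n → Set
IsLeader σ i = ∀ j → toℕ j < toℕ i → ¬ SameCycle σ j i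

isLeader? : ∀ {n} (σ : Fun n) i → Dec (IsLeader σ i)
isLeader? σ i = FinP.all? λ j → (toℕ j <? toℕ i) →-dec ¬? (sameCycle? σ j i)

cycles : ∀ {n} → Fun n → ℕ
cycles {n} σ = length (filter (isLeader? σ) (allFin n))

-- the elements 1,…,r lie in distinct cycles
RSeparated : ∀ {n} → ℕ → Fun n → Set
RSeparated r σ = ∀ i j → toℕ i < toℕ j → toℕ j < r → ¬ SameCycle σ i j

rSeparated? : ∀ {n} r (σ : Fun n) → Dec (RSeparated r σ)
rSeparated? r σ = FinP.all? λ i → FinP.all? λ j →
  (toℕ i <? toℕ j) →-dec ((toℕ j <? r) →-dec ¬? (sameCycle? σ i j))

rStirling1 : (n m r : ℕ) → ℕ
rStirling1 n m r = length (filter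
  (λ σ → isPerm? σ ×-dec (rSeparated? r σ ×-dec (cycles σ ≟ m)))
  (allVecs n n))

-- Colourings of cycles: a map c : [n] → colours constant on cycles.
-- Colours {1,…,k} are encoded as Fin k; Fin.zero is the special colour 1.
ConstOnCycles : ∀ {n k} → Fun n → Vec (Fin k) n → Set
ConstOnCycles σ c = ∀ i j → SameCycle σ i j → lookup c i ≡ lookup c j

constOnCycles? : ∀ {n k} (σ : Fun n) (c : Vec (Fin k) n) → Dec (ConstOnCycles σ c)
constOnCycles? σ c = FinP.all? λ i → FinP.all? λ j →
  sameCycle? σ i j →-dec (lookup c i FinP.≟ lookup c j)

cyclesOfColour : ∀ {n k} → Fun n → Vec (Fin k) n → Fin k → ℕ
cyclesOfColour {n} σ c a =
  length (filter (λ i → isLeader? σ i ×-dec (lookup c i FinP.≟ a)) (allFin n))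

required : ∀ {k} → ℕ → Fin k → ℕ
required t zero    = t
required t (suc _) = 1

ColourOK : ∀ {n k} → ℕ → Fun n → Vec (Fin k) n → Set
ColourOK t σ c = ∀ a → cyclesOfColour σ c a ≡ required t a

colourOK? : ∀ {n k} t (σ : Fun n) (c : Vec (Fin k) n) → Dec (ColourOK t σ c)
colourOK? t σ c = FinP.all? λ a → cyclesOfColour σ c a ≟ required t a

pairs : ∀ {A B : Set} → List A → List B → List (A × B)
pairs xs ys = concatMap (λ x → map (x ,_) ys) xs

rMixed : (n k t r : ℕ) → ℕ
rMixed n k t r = length (filter
  (λ p → isPerm? (proj₁ p) ×-dec (rSeparated? r (proj₁ p) ×-dec
         (constOnCycles? (proj₁ p) (proj₂ p) ×-dec colourOK? t (proj₁ p) (proj₂ p))))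
  (pairs (allVecs n n) (allVecs n k)))

fall : ℕ → ℕ → ℕ
fall x zero    = 1
fall x (suc m) = x * fall (x ∸ 1) m

-- The r-mixed coloured permutations of [n] with parameters k, t are counted
-- by fixing the underlying permutation σ first.
--
-- * Counting (general): counting the pairs (σ , c) that satisfy a predicate
--   reduces to summing, over σ, the number of admissible second components.
-- * Cycles: for a permutation σ, "lie in the same cycle" is an equivalence
--   relation; every cycle has a least element, its leader.
-- * Colourings: a colouring constant on the cycles of σ is the same thing as
--   a word of length (cycles σ) over the colours, read off at the leaders; the
--   colour condition becomes "colour 1 occurs t times, every other colour
--   exactly once".
-- * Words: by recursion on the first letter, the number of words of length m
--   in which one letter occurs t times and s further letters once each is
--   (m)_s if m = t + s and 0 otherwise.
--
-- Hence every r-separated permutation with t + k - 1 cycles carries exactly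
-- (t + k - 1)_(k-1) admissible colourings, every other one carries none, and
-- the theorem follows by double counting.
module Submission where

open import Defs
open import Level using (Level)
open import Function using (_∘_)
open import Data.Nat using (ℕ; zero; suc; _+_; _*_; _∸_; _≤_; _<_; z≤n; s≤s; s≤s⁻¹; pred; _%_; _/_)
open import Data.Nat.Properties
open import Data.Nat.DivMod using (m≡m%n+[m/n]*n; m%n<n)
open import Data.Bool using (if_then_else_)
open import Data.Fin using (Fin; zero; suc; toℕ; fromℕ<)
import Data.Fin.Properties as FinP
open import Data.Vec using (Vec; []; _∷_; lookup; tabulate; fromList)
import Data.Vec as Vec
import Data.Vec.Properties as VecP
open import Data.List
  using (List; []; _∷_; _++_; map; concatMap; filter; length; allFin; cartesianProductWith)
open import Data.List.Properties
  using (filter-++; length-++; filter-≐; filter-none; filter-accept; filter-reject)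
open import Data.List.Membership.Propositional using (_∈_)
open import Data.List.Membership.Propositional.Properties
  using (∈-filter⁺; ∈-filter⁻; ∈-++⁻; ∈-++⁺ˡ; ∈-++⁺ʳ; ∈-∃++; ∈-allFin; ∈-cartesianProductWith⁺; ∈-lookup)
open import Data.List.Relation.Unary.Any as Any using (here; there)
import Data.List.Relation.Unary.Any.Properties as AnyP
open import Data.List.Relation.Unary.AllPairs using ([]; _∷_)
import Data.List.Relation.Unary.All as All
open import Data.List.Relation.Unary.Unique.Propositional using (Unique)
import Data.List.Relation.Unary.Unique.Propositional.Properties as Unique
open import Data.Product using (Σ; ∃; _×_; _,_; proj₁; proj₂)
open import Data.Sum using (inj₁; inj₂)
open import Data.Empty using (⊥-elim)
open import Relation.Nullary using (¬_; Dec; yes; no; does; _×-dec_)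
open import Relation.Unary using (Pred; Decidable)
open import Relation.Binary.PropositionalEquality
open import Relation.Binary.Definitions using (tri<; tri≈; tri>)
open import Algebra.Properties.Semiring.Sum +-*-semiring using (sum; sum-syntax; sum-cong-≗; *-distribʳ-sum)

private variable
  ℓa ℓb ℓp ℓq : Level
  A : Set ℓa
  B : Set ℓb

count : {P : Pred A ℓp} → Decidable P → List A → ℕ
count P? xs = length (filter P? xs)

count-++ : {P : Pred A ℓp} (P? : Decidable P) (xs ys : List A) →
  count P? (xs ++ ys) ≡ count P? xs + count P? ys
count-++ P? xs ys = trans (cong length (filter-++ P? xs ys)) (length-++ (filter P? xs))

count-map : {P : Pred B ℓp} (P? : Decidable P) (f : A → B) (xs : List A) →
  count P? (map f xs) ≡ count (P? ∘ f) xs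
count-map P? f [] = refl
count-map P? f (x ∷ xs) with P? (f x)
... | yes _ = cong suc (count-map P? f xs)
... | no _  = count-map P? f xs

count-≐ : {P : Pred A ℓp} {Q : Pred A ℓq} (P? : Decidable P) (Q? : Decidable Q) →
  (∀ {x} → P x → Q x) → (∀ {x} → Q x → P x) → (xs : List A) → count P? xs ≡ count Q? xs
count-≐ P? Q? pq qp xs = cong length (filter-≐ P? Q? (pq , qp) xs)

count-none : {P : Pred A ℓp} (P? : Decidable P) → (∀ x → ¬ P x) → (xs : List A) → count P? xs ≡ 0
count-none P? ¬P xs = cong length (filter-none P? (All.universal ¬P xs))

count-×-dec : {P : Pred A ℓp} {Q : Pred A ℓq} (P? : Decidable P) (Q? : Decidable Q) (xs : List A) →
  count (λ x → P? x ×-dec Q? x) xs ≡ count Q? (filter P? xs)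
count-×-dec P? Q? [] = refl
count-×-dec P? Q? (x ∷ xs) with P? x | Q? x
... | yes _ | yes qx = trans (cong suc (count-×-dec P? Q? xs))
                              (sym (cong length (filter-accept Q? {xs = filter P? xs} qx)))
... | yes _ | no ¬qx = trans (count-×-dec P? Q? xs)
                              (sym (cong length (filter-reject Q? {xs = filter P? xs} ¬qx)))
... | no _  | _    = count-×-dec P? Q? xs

count-concatMap-tabulate : {P : Pred A ℓp} (P? : Decidable P) {k : ℕ} (g : Fin k → B)
  (blocks : B → List A) →
  count P? (concatMap blocks (Data.List.tabulate g)) ≡ (∑[ i < k ] count P? (blocks (g i)))
count-concatMap-tabulate P? {zero}  g blocks = refl
count-concatMap-tabulate P? {suc k} g blocks =
  trans (count-++ P? (blocks (g zero)) _)
        (cong (count P? (blocks (g zero)) +_) (count-concatMap-tabulate P? (g ∘ suc) blocks))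

count-pairs : {P : Pred (A × B) ℓp} (P? : Decidable P) {Q : Pred A ℓq} (Q? : Decidable Q)
  (F : ℕ) (ys : List B) →
  (∀ x → Q x → count (λ y → P? (x , y)) ys ≡ F) →
  (∀ x → ¬ Q x → count (λ y → P? (x , y)) ys ≡ 0) →
  (xs : List A) → count P? (pairs xs ys) ≡ F * count Q? xs
count-pairs P? Q? F ys good bad [] = sym (*-zeroʳ F)
count-pairs P? Q? F ys good bad (x ∷ xs) = begin
  count P? (map (x ,_) ys ++ pairs xs ys)
    ≡⟨ count-++ P? (map (x ,_) ys) (pairs xs ys) ⟩
  count P? (map (x ,_) ys) + count P? (pairs xs ys)
    ≡⟨ cong₂ _+_ (count-map P? (x ,_) ys) (count-pairs P? Q? F ys good bad xs) ⟩
  count (λ y → P? (x , y)) ys + F * count Q? xs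
    ≡⟨ countHead ⟩
  F * count Q? (x ∷ xs) ∎
  where
  open ≡-Reasoning
  countHead : count (λ y → P? (x , y)) ys + F * count Q? xs ≡ F * count Q? (x ∷ xs)
  countHead with Q? x
  ... | yes qx = trans (cong (_+ F * count Q? xs) (good x qx)) (sym (*-suc F (count Q? xs)))
  ... | no ¬qx = cong (_+ F * count Q? xs) (bad x ¬qx)

-- A duplicate-free list that embeds into another list (via f, undone by g)
-- is at most as long: remove the image of the head and recurse.
length-≤-embedding : (f : A → B) (g : B → A) (ws : List A) (vs : List B) → Unique ws →
  (∀ {w} → w ∈ ws → f w ∈ vs × g (f w) ≡ w) → length ws ≤ length vs
length-≤-embedding f g []       vs _            _   = z≤n
length-≤-embedding f g (w ∷ ws) vs (w∉ws ∷ uws) emb with ∈-∃++ (proj₁ (emb (here refl)))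
... | vs₁ , vs₂ , refl = begin
  suc (length ws)               ≤⟨ s≤s (length-≤-embedding f g ws (vs₁ ++ vs₂) uws emb′) ⟩
  suc (length (vs₁ ++ vs₂))     ≡⟨ cong suc (length-++ vs₁) ⟩
  suc (length vs₁ + length vs₂) ≡⟨ sym (+-suc (length vs₁) (length vs₂)) ⟩
  length vs₁ + length (f w ∷ vs₂) ≡⟨ sym (length-++ vs₁) ⟩
  length (vs₁ ++ f w ∷ vs₂)     ∎
  where
  open ≤-Reasoning
  -- the removed position is the image of w only, since g (f w′) = w′ ≠ w
  emb′ : ∀ {w′} → w′ ∈ ws → f w′ ∈ vs₁ ++ vs₂ × g (f w′) ≡ w′
  emb′ {w′} w′∈ws with emb (there w′∈ws)
  ... | fw′∈ , gfw′ with ∈-++⁻ vs₁ fw′∈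
  ...   | inj₁ ∈vs₁          = ∈-++⁺ˡ ∈vs₁ , gfw′
  ...   | inj₂ (there ∈vs₂)  = ∈-++⁺ʳ vs₁ ∈vs₂ , gfw′
  ...   | inj₂ (here fw′≡fw) =
    ⊥-elim (All.lookup w∉ws w′∈ws (trans (sym (proj₂ (emb (here refl))))
                                         (trans (cong g (sym fw′≡fw)) gfw′)))

count-≤-embedding : {P : Pred A ℓp} {Q : Pred B ℓq} (P? : Decidable P) (Q? : Decidable Q)
  (f : A → B) (g : B → A) (xs : List A) (ys : List B) → Unique xs →
  (∀ {x} → x ∈ xs → P x → f x ∈ ys × Q (f x) × g (f x) ≡ x) →
  count P? xs ≤ count Q? ys
count-≤-embedding P? Q? f g xs ys uxs fwd =
  length-≤-embedding f g (filter P? xs) (filter Q? ys) (Unique.filter⁺ P? uxs) λ w∈ →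
    let x∈ , px = ∈-filter⁻ P? w∈ ; fx∈ , qfx , gfx = fwd x∈ px
    in ∈-filter⁺ Q? fx∈ qfx , gfx

count-bijection : {P : Pred A ℓp} {Q : Pred B ℓq} (P? : Decidable P) (Q? : Decidable Q)
  (f : A → B) (g : B → A) (xs : List A) (ys : List B) → Unique xs → Unique ys →
  (∀ {x} → x ∈ xs → P x → f x ∈ ys × Q (f x) × g (f x) ≡ x) →
  (∀ {y} → y ∈ ys → Q y → g y ∈ xs × P (g y) × f (g y) ≡ y) →
  count P? xs ≡ count Q? ys
count-bijection P? Q? f g xs ys uxs uys fwd bwd =
  ≤-antisym (count-≤-embedding P? Q? f g xs ys uxs fwd) (count-≤-embedding Q? P? g f ys xs uys bwd)

index-unique : ∀ {xs : List A} {y} → Unique xs → (y∈xs : y ∈ xs) (j : Fin (length xs)) →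
  y ≡ Data.List.lookup xs j → Any.index y∈xs ≡ j
index-unique _          (here _)     zero    _    = refl
index-unique (x∉xs ∷ _) (here y≡x)   (suc j) y≡xⱼ =
  ⊥-elim (All.lookup x∉xs (∈-lookup j) (trans (sym y≡x) y≡xⱼ))
index-unique (x∉xs ∷ _) (there y∈xs) zero    y≡x  =
  ⊥-elim (All.lookup x∉xs (subst (_∈ _) y≡x y∈xs) refl)
index-unique (_ ∷ uxs)  (there y∈xs) (suc j) y≡xⱼ = cong suc (index-unique uxs y∈xs j y≡xⱼ)

lookup-fromList : (xs : List A) (j : Fin (length xs)) → lookup (fromList xs) j ≡ Data.List.lookup xs j
lookup-fromList (x ∷ xs) zero    = refl
lookup-fromList (x ∷ xs) (suc j) = lookup-fromList xs j

vec-ext : ∀ {m} {u v : Vec A m} → (∀ j → lookup u j ≡ lookup v j) → u ≡ v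
vec-ext {u = u} {v} u≗v =
  trans (sym (VecP.tabulate∘lookup u)) (trans (VecP.tabulate-cong u≗v) (VecP.tabulate∘lookup v))

least : ∀ {n} {P : Pred (Fin n) ℓp} → Decidable P → (i : Fin n) → P i →
  Σ (Fin n) λ j → P j × (∀ j′ → toℕ j′ < toℕ j → ¬ P j′)
least {n = suc n} {P = P} P? i pi with P? zero
... | yes p0 = zero , p0 , λ _ ()
... | no ¬p0 with i
...   | zero   = ⊥-elim (¬p0 pi)
...   | suc i′ with least (P? ∘ suc) i′ pi
...     | j , pj , below-j = suc j , pj , below-suc-j
  where
  below-suc-j : ∀ j′ → toℕ j′ < toℕ (suc j) → ¬ P j′
  below-suc-j zero     _  = ¬p0
  below-suc-j (suc j″) lt = below-j j″ (s≤s⁻¹ lt)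

least-unique : ∀ {n} {P : Pred (Fin n) ℓp} {Q : Pred (Fin n) ℓq} {i j : Fin n} →
  P i → (∀ i′ → toℕ i′ < toℕ i → ¬ P i′) → Q j → (∀ j′ → toℕ j′ < toℕ j → ¬ Q j′) →
  (∀ {x} → P x → Q x) → (∀ {x} → Q x → P x) → i ≡ j
least-unique {i = i} {j} pi least-i qj least-j pq qp with <-cmp (toℕ i) (toℕ j)
... | tri< i<j _ _ = ⊥-elim (least-j i i<j (pq pi))
... | tri≈ _ i≡j _ = FinP.toℕ-injective i≡j
... | tri> _ _ j<i = ⊥-elim (least-i j j<i (qp qj))

module Cycles {n : ℕ} (σ : Fun n) (perm : IsPerm σ) where

  iter-+ : ∀ a b i → iter σ (a + b) i ≡ iter σ a (iter σ b i)
  iter-+ zero    b i = refl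
  iter-+ (suc a) b i = cong (lookup σ) (iter-+ a b i)

  iter-injective : ∀ a {x y} → iter σ a x ≡ iter σ a y → x ≡ y
  iter-injective zero    e = e
  iter-injective (suc a) e = iter-injective a (perm _ _ e)

  -- Every orbit is periodic with period at most n (pigeonhole on σ⁰ i, …, σⁿ i).
  period : ∀ i → ∃ λ p → 0 < p × p ≤ n × iter σ p i ≡ i
  period i with FinP.pigeonhole (n<1+n n) (λ (j : Fin (suc n)) → iter σ (toℕ j) i)
  ... | a , b , a<b , σᵃi≡σᵇi = d , m<n⇒0<n∸m a<b , d≤n , σᵈi≡i
    where
    d = toℕ b ∸ toℕ a
    d≤n : d ≤ n
    d≤n = ≤-trans (m∸n≤m (toℕ b) (toℕ a)) (s≤s⁻¹ (FinP.toℕ<n b))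
    σᵈi≡i : iter σ d i ≡ i
    σᵈi≡i = sym (iter-injective (toℕ a) (begin
      iter σ (toℕ a) i            ≡⟨ σᵃi≡σᵇi ⟩
      iter σ (toℕ b) i            ≡⟨ cong (λ e → iter σ e i) (sym (m+[n∸m]≡n (<⇒≤ a<b))) ⟩
      iter σ (toℕ a + d) i        ≡⟨ iter-+ (toℕ a) d i ⟩
      iter σ (toℕ a) (iter σ d i) ∎))
      where open ≡-Reasoning

  iter-multiple : ∀ p i → iter σ p i ≡ i → ∀ q → iter σ (q * p) i ≡ i
  iter-multiple p i σᵖi≡i zero    = refl
  iter-multiple p i σᵖi≡i (suc q) =
    trans (iter-+ p (q * p) i) (trans (cong (iter σ p) (iter-multiple p i σᵖi≡i q)) σᵖi≡i)

  -- SameCycle only looks at exponents below n, but any exponent can be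
  -- reduced modulo the period.
  reachable⇒sameCycle : ∀ m i j → iter σ m i ≡ j → SameCycle σ i j
  reachable⇒sameCycle m i j σᵐi≡j with period i
  ... | suc p′ , _ , p≤n , σᵖi≡i =
    fromℕ< m%p<n , trans (cong (λ e → iter σ e i) (FinP.toℕ-fromℕ< m%p<n)) σʳi≡j
    where
    p = suc p′
    m%p<n : m % p < n
    m%p<n = <-≤-trans (m%n<n m p) p≤n
    σʳi≡j : iter σ (m % p) i ≡ j
    σʳi≡j = begin
      iter σ (m % p) i                        ≡⟨ cong (iter σ (m % p)) (iter-multiple p i σᵖi≡i (m / p)) ⟨
      iter σ (m % p) (iter σ ((m / p) * p) i) ≡⟨ iter-+ (m % p) ((m / p) * p) i ⟨
      iter σ (m % p + (m / p) * p) i          ≡⟨ cong (λ e → iter σ e i) (m≡m%n+[m/n]*n m p) ⟨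
      iter σ m i                              ≡⟨ σᵐi≡j ⟩
      j                                       ∎
      where open ≡-Reasoning

  sameCycle-refl : ∀ i → SameCycle σ i i
  sameCycle-refl i = reachable⇒sameCycle 0 i i refl

  sameCycle-trans : ∀ {i j l} → SameCycle σ i j → SameCycle σ j l → SameCycle σ i l
  sameCycle-trans {i} {j} {l} (a , σᵃi≡j) (b , σᵇj≡l) = reachable⇒sameCycle (toℕ b + toℕ a) i l
    (trans (iter-+ (toℕ b) (toℕ a) i) (trans (cong (iter σ (toℕ b)) σᵃi≡j) σᵇj≡l))

  -- Going backwards by a equals going forwards by (p - 1) · a, p the period.
  sameCycle-sym : ∀ {i j} → SameCycle σ i j → SameCycle σ j i
  sameCycle-sym {i} {j} (a , σᵃi≡j) with period i
  ... | suc p′ , _ , _ , σᵖi≡i = reachable⇒sameCycle (p′ * toℕ a) j i (begin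
    iter σ (p′ * toℕ a) j                     ≡⟨ cong (iter σ (p′ * toℕ a)) (sym σᵃi≡j) ⟩
    iter σ (p′ * toℕ a) (iter σ (toℕ a) i)    ≡⟨ sym (iter-+ (p′ * toℕ a) (toℕ a) i) ⟩
    iter σ (p′ * toℕ a + toℕ a) i             ≡⟨ cong (λ e → iter σ e i) exponent ⟩
    iter σ (toℕ a * suc p′) i                 ≡⟨ iter-multiple (suc p′) i σᵖi≡i (toℕ a) ⟩
    i                                         ∎)
    where
    open ≡-Reasoning
    exponent : p′ * toℕ a + toℕ a ≡ toℕ a * suc p′
    exponent = trans (+-comm (p′ * toℕ a) (toℕ a))
                     (trans (cong (toℕ a +_) (*-comm p′ (toℕ a))) (sym (*-suc (toℕ a) p′)))

  leaderOf : Fin n → Fin n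
  leaderOf i = proj₁ (least (λ j → sameCycle? σ j i) i (sameCycle-refl i))

  leaderOf-sameCycle : ∀ i → SameCycle σ (leaderOf i) i
  leaderOf-sameCycle i = proj₁ (proj₂ (least (λ j → sameCycle? σ j i) i (sameCycle-refl i)))

  leaderOf-least : ∀ i j → toℕ j < toℕ (leaderOf i) → ¬ SameCycle σ j i
  leaderOf-least i = proj₂ (proj₂ (least (λ j → sameCycle? σ j i) i (sameCycle-refl i)))

  leaderOf-isLeader : ∀ i → IsLeader σ (leaderOf i)
  leaderOf-isLeader i j j<ℓ j~ℓ = leaderOf-least i j j<ℓ (sameCycle-trans j~ℓ (leaderOf-sameCycle i))

  leaderOf-cong : ∀ {i j} → SameCycle σ i j → leaderOf i ≡ leaderOf j
  leaderOf-cong {i} {j} i~j = least-unique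
    (leaderOf-sameCycle i) (leaderOf-least i) (leaderOf-sameCycle j) (leaderOf-least j)
    (λ x~i → sameCycle-trans x~i i~j) (λ x~j → sameCycle-trans x~j (sameCycle-sym i~j))

  leaderOf-leader : ∀ {x} → IsLeader σ x → leaderOf x ≡ x
  leaderOf-leader {x} x-leads = least-unique
    (leaderOf-sameCycle x) (leaderOf-least x) (sameCycle-refl x) x-leads (λ h → h) (λ h → h)

allVecs-suc : ∀ m k → allVecs (suc m) k ≡ cartesianProductWith _∷_ (allFin k) (allVecs m k)
allVecs-suc m k = go (allFin k)
  where
  go : ∀ xs → concatMap (λ x → map (x ∷_) (allVecs m k)) xs ≡ cartesianProductWith _∷_ xs (allVecs m k)
  go []       = refl
  go (x ∷ xs) = cong (map (x ∷_) (allVecs m k) ++_) (go xs)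

allVecs-complete : ∀ {m k} (w : Vec (Fin k) m) → w ∈ allVecs m k
allVecs-complete []              = here refl
allVecs-complete {suc m} {k} (x ∷ w) = subst ((x ∷ w) ∈_) (sym (allVecs-suc m k))
  (∈-cartesianProductWith⁺ _∷_ (∈-allFin x) (allVecs-complete w))

allVecs-unique : ∀ m k → Unique (allVecs m k)
allVecs-unique zero    k = All.[] ∷ []
allVecs-unique (suc m) k = subst Unique (sym (allVecs-suc m k))
  (Unique.cartesianProductWith⁺ _∷_ VecP.∷-injective (Unique.allFin⁺ k) (allVecs-unique m k))

occurrences : ∀ {k m} → Fin k → Vec (Fin k) m → ℕ
occurrences x w = count (FinP._≟ x) (Vec.toList w)

HasContent : ∀ {k m} → (Fin k → ℕ) → Vec (Fin k) m → Set
HasContent req w = ∀ x → occurrences x w ≡ req x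

hasContent? : ∀ {k m} (req : Fin k → ℕ) → Decidable (HasContent {k} {m} req)
hasContent? req w = FinP.all? λ x → occurrences x w Data.Nat.≟ req x

withContent : ∀ {k} → ℕ → (Fin k → ℕ) → ℕ
withContent {k} m req = count (hasContent? req) (allVecs m k)

removeOne : ∀ {k} → Fin k → (Fin k → ℕ) → Fin k → ℕ
removeOne x req y = if does (x FinP.≟ y) then pred (req y) else req y

hasContent-∷⁻ : ∀ {k m} (req : Fin k → ℕ) x (w : Vec (Fin k) m) →
  HasContent req (x ∷ w) → HasContent (removeOne x req) w
hasContent-∷⁻ req x w x∷w-ok y with x FinP.≟ y | x∷w-ok y
... | yes _ | occ≡ = cong pred occ≡
... | no _  | occ≡ = occ≡

hasContent-∷⁺ : ∀ {k m} (req : Fin k → ℕ) x r (w : Vec (Fin k) m) → req x ≡ suc r →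
  HasContent (removeOne x req) w → HasContent req (x ∷ w)
hasContent-∷⁺ req x r w req-x w-ok y with x FinP.≟ y | w-ok y
... | yes refl | occ≡ = trans (cong suc occ≡) (trans (cong (λ v → suc (pred v)) req-x) (sym req-x))
... | no _     | occ≡ = occ≡

hasContent-∷-absent : ∀ {k m} (req : Fin k → ℕ) x (w : Vec (Fin k) m) → req x ≡ 0 →
  ¬ HasContent req (x ∷ w)
hasContent-∷-absent req x w req-x x∷w-ok with x FinP.≟ x | x∷w-ok x
... | yes _ | occ≡ = 1+n≢0 (trans occ≡ req-x)
... | no x≢x | _   = x≢x refl

withContent-suc : ∀ {k} m (req : Fin k → ℕ) →
  withContent (suc m) req ≡ (∑[ x < k ] count (hasContent? req ∘ (x ∷_)) (allVecs m k))
withContent-suc {k} m req =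
  trans (count-concatMap-tabulate (hasContent? req) (λ x → x) (λ x → map (x ∷_) (allVecs m k)))
        (sum-cong-≗ λ x → count-map (hasContent? req) (x ∷_) (allVecs m k))

startingWith-absent : ∀ {k} m (req : Fin k → ℕ) x → req x ≡ 0 →
  count (hasContent? req ∘ (x ∷_)) (allVecs m k) ≡ 0
startingWith-absent {k} m req x req-x =
  count-none (hasContent? req ∘ (x ∷_)) (λ w → hasContent-∷-absent req x w req-x) (allVecs m k)

startingWith-present : ∀ {k} m (req : Fin k → ℕ) x r → req x ≡ suc r →
  count (hasContent? req ∘ (x ∷_)) (allVecs m k) ≡ withContent m (removeOne x req)
startingWith-present {k} m req x r req-x =
  count-≐ (hasContent? req ∘ (x ∷_)) (hasContent? (removeOne x req))
    (hasContent-∷⁻ req x _) (hasContent-∷⁺ req x r _ req-x) (allVecs m k)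

-- arrangements m t s counts the words of length m in which a distinguished
-- letter occurs t times and each of s further letters exactly once, by
-- their first letter: the distinguished one (if t > 0) or one of the s others.
arrangements : ℕ → ℕ → ℕ → ℕ
arrangements zero    zero    zero    = 1
arrangements zero    zero    (suc _) = 0
arrangements zero    (suc _) _       = 0
arrangements (suc m) zero    s       = s * arrangements m zero (pred s)
arrangements (suc m) (suc t) s       = arrangements m t s + s * arrangements m (suc t) (pred s)

sum-≡0⁻ : ∀ {k} (g : Fin k → ℕ) → sum g ≡ 0 → ∀ y → g y ≡ 0
sum-≡0⁻ {suc k} g Σ≡0 zero    = m+n≡0⇒m≡0 (g zero) Σ≡0
sum-≡0⁻ {suc k} g Σ≡0 (suc y) = sum-≡0⁻ (g ∘ suc) (m+n≡0⇒n≡0 (g zero) Σ≡0) y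

sum-≡0⁺ : ∀ {k} (g : Fin k → ℕ) → (∀ y → g y ≡ 0) → sum g ≡ 0
sum-≡0⁺ {zero}  g g≡0 = refl
sum-≡0⁺ {suc k} g g≡0 = cong₂ _+_ (g≡0 zero) (sum-≡0⁺ (g ∘ suc) (g≡0 ∘ suc))

sum-ones : ∀ k → (∑[ y < k ] 1) ≡ k
sum-ones zero    = refl
sum-ones (suc k) = cong suc (sum-ones k)

sum-removeOne : ∀ {k} (req : Fin k → ℕ) x r → req x ≡ suc r → sum req ≡ suc (sum (removeOne x req))
sum-removeOne {suc k} req zero    r req-x rewrite req-x = refl
sum-removeOne {suc k} req (suc x) r req-x =
  trans (cong (req zero +_) (sum-removeOne (req ∘ suc) x r req-x)) (+-suc (req zero) _)

removeOne-≤ : ∀ {k} x (req : Fin k → ℕ) y → removeOne x req y ≤ req y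
removeOne-≤ x req y with x FinP.≟ y
... | yes _ = pred[n]≤n
... | no _  = ≤-refl

withContent-zero : ∀ {k} (req : Fin (suc k) → ℕ) →
  withContent 0 req ≡ arrangements 0 (req zero) (∑[ y < k ] req (suc y))
withContent-zero {k} req with hasContent? req []
... | yes []-ok = begin
  count (hasContent? req) ([] ∷ [])
    ≡⟨ cong length (filter-accept (hasContent? req) {x = []} {xs = []} []-ok) ⟩
  arrangements 0 0 0                  ≡⟨ cong₂ (arrangements 0) ([]-ok zero)
                                            (sym (sum-≡0⁺ (req ∘ suc) (λ y → sym ([]-ok (suc y))))) ⟩
  arrangements 0 (req zero) (∑[ y < k ] req (suc y)) ∎
  where open ≡-Reasoning
... | no ¬[]-ok = trans (cong length (filter-reject (hasContent? req) {x = []} {xs = []} ¬[]-ok))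
                        (sym (nothing-required (req zero) (∑[ y < k ] req (suc y)) refl refl))
  where
  nothing-required : ∀ t s → req zero ≡ t → (∑[ y < k ] req (suc y)) ≡ s → arrangements 0 t s ≡ 0
  nothing-required zero    zero    t≡0 s≡0 = ⊥-elim (¬[]-ok λ
    { zero    → sym t≡0
    ; (suc y) → sym (sum-≡0⁻ (req ∘ suc) s≡0 y) })
  nothing-required zero    (suc _) _ _ = refl
  nothing-required (suc _) _       _ _ = refl

withContent-arrangements : ∀ {k} m (req : Fin (suc k) → ℕ) → (∀ y → req (suc y) ≤ 1) →
  withContent m req ≡ arrangements m (req zero) (∑[ y < k ] req (suc y))
withContent-arrangements zero req _ = withContent-zero req
withContent-arrangements {k} (suc m) req atMostOnce = begin
  withContent (suc m) req                                  ≡⟨ withContent-suc m req ⟩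
  start zero + (∑[ y < k ] start (suc y))                  ≡⟨ cong (start zero +_) others ⟩
  start zero + s * arrangements m (req zero) (pred s)      ≡⟨ byFirstLetter (req zero) refl ⟩
  arrangements (suc m) (req zero) s                        ∎
  where
  open ≡-Reasoning
  s = ∑[ y < k ] req (suc y)
  start : Fin (suc k) → ℕ
  start x = count (hasContent? req ∘ (x ∷_)) (allVecs m (suc k))

  -- a word may start with the letter suc y only if it is required (once)
  startOther : ∀ y → start (suc y) ≡ req (suc y) * arrangements m (req zero) (pred s)
  startOther y with req (suc y) in req-y | atMostOnce y
  ... | zero     | _ = startingWith-absent m req (suc y) req-y
  ... | suc zero | _ = begin
    start (suc y)
      ≡⟨ startingWith-present m req (suc y) 0 req-y ⟩
    withContent m (removeOne (suc y) req)
      ≡⟨ withContent-arrangements m (removeOne (suc y) req)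
           (λ z → ≤-trans (removeOne-≤ (suc y) req (suc z)) (atMostOnce z)) ⟩
    arrangements m (req zero) (sum (removeOne (suc y) req ∘ suc))
      ≡⟨ cong (arrangements m (req zero) ∘ pred) (sum-removeOne (req ∘ suc) y 0 req-y) ⟨
    arrangements m (req zero) (pred s)
      ≡⟨ +-identityʳ _ ⟨
    1 * arrangements m (req zero) (pred s) ∎
  ... | suc (suc _) | s≤s ()

  others : (∑[ y < k ] start (suc y)) ≡ s * arrangements m (req zero) (pred s)
  others = trans (sum-cong-≗ startOther)
                 (sym (*-distribʳ-sum (arrangements m (req zero) (pred s)) (req ∘ suc)))

  -- a word may start with the letter 0 only if it is required
  byFirstLetter : ∀ t → req zero ≡ t →
    start zero + s * arrangements m t (pred s) ≡ arrangements (suc m) t s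
  byFirstLetter zero    req-0 =
    cong (_+ s * arrangements m zero (pred s)) (startingWith-absent m req zero req-0)
  byFirstLetter (suc t) req-0 = cong (_+ s * arrangements m (suc t) (pred s)) (begin
    start zero                              ≡⟨ startingWith-present m req zero t req-0 ⟩
    withContent m (removeOne zero req)      ≡⟨ withContent-arrangements m (removeOne zero req) atMostOnce ⟩
    arrangements m (pred (req zero)) s      ≡⟨ cong (λ v → arrangements m (pred v) s) req-0 ⟩
    arrangements m t s                      ∎)

fall-suc : ∀ x j → fall x (suc j) ≡ fall x j * (x ∸ j)
fall-suc x zero    = trans (*-identityʳ x) (sym (+-identityʳ x))
fall-suc x (suc j) = begin
  x * fall (x ∸ 1) (suc j)          ≡⟨ cong (x *_) (fall-suc (x ∸ 1) j) ⟩
  x * (fall (x ∸ 1) j * (x ∸ 1 ∸ j)) ≡⟨ sym (*-assoc x (fall (x ∸ 1) j) (x ∸ 1 ∸ j)) ⟩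
  x * fall (x ∸ 1) j * (x ∸ 1 ∸ j)   ≡⟨ cong (x * fall (x ∸ 1) j *_) (∸-+-assoc x 1 j) ⟩
  x * fall (x ∸ 1) j * (x ∸ suc j)   ∎
  where open ≡-Reasoning

fall-pascal : ∀ m s → s ≤ m → fall (suc m) (suc s) ≡ fall m (suc s) + suc s * fall m s
fall-pascal m s s≤m = begin
  suc m * fall m s
    ≡⟨ cong (_* fall m s) (trans (+-suc (m ∸ s) s) (cong suc (m∸n+n≡m s≤m))) ⟨
  (m ∸ s + suc s) * fall m s
    ≡⟨ *-distribʳ-+ (fall m s) (m ∸ s) (suc s) ⟩
  (m ∸ s) * fall m s + suc s * fall m s
    ≡⟨ cong (_+ suc s * fall m s) (trans (*-comm (m ∸ s) (fall m s)) (sym (fall-suc m s))) ⟩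
  fall m (suc s) + suc s * fall m s ∎
  where open ≡-Reasoning

arrangements-closed : ∀ m t s → m ≡ t + s → arrangements m t s ≡ fall m s
arrangements-closed zero    zero    zero    _    = refl
arrangements-closed (suc m) zero    (suc s) refl = cong (suc m *_) (arrangements-closed m zero s refl)
arrangements-closed (suc m) (suc t) zero    m≡t  =
  trans (+-identityʳ _) (arrangements-closed m t zero (suc-injective m≡t))
arrangements-closed (suc m) (suc t) (suc s) m≡ts = begin
  arrangements m t (suc s) + suc s * arrangements m (suc t) s
    ≡⟨ cong₂ (λ u v → u + suc s * v) (arrangements-closed m t (suc s) m≡t+1+s)
                                      (arrangements-closed m (suc t) s (trans m≡t+1+s (+-suc t s))) ⟩
  fall m (suc s) + suc s * fall m s ≡⟨ sym (fall-pascal m s s≤m) ⟩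
  fall (suc m) (suc s)              ∎
  where
  open ≡-Reasoning
  m≡t+1+s : m ≡ t + suc s
  m≡t+1+s = suc-injective m≡ts
  s≤m : s ≤ m
  s≤m = subst (s ≤_) (sym m≡t+1+s) (≤-trans (n≤1+n s) (m≤n+m (suc s) t))

arrangements-other : ∀ m t s → m ≢ t + s → arrangements m t s ≡ 0
arrangements-other zero    zero    zero    m≢ = ⊥-elim (m≢ refl)
arrangements-other zero    zero    (suc s) _  = refl
arrangements-other zero    (suc t) s       _  = refl
arrangements-other (suc m) zero    zero    _  = refl
arrangements-other (suc m) zero    (suc s) m≢ =
  trans (cong (suc s *_) (arrangements-other m zero s (m≢ ∘ cong suc))) (*-zeroʳ (suc s))
arrangements-other (suc m) (suc t) zero    m≢ =
  trans (+-identityʳ _) (arrangements-other m t zero (m≢ ∘ cong suc))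
arrangements-other (suc m) (suc t) (suc s) m≢ = cong₂ _+_
  (arrangements-other m t (suc s) (m≢ ∘ cong suc))
  (trans (cong (suc s *_) (arrangements-other m (suc t) s m≢′)) (*-zeroʳ (suc s)))
  where
  m≢′ : m ≢ suc t + s
  m≢′ m≡ = m≢ (cong suc (trans m≡ (sym (+-suc t s))))

-- Colourings of the cycles of a permutation σ with k colours correspond to
-- words of length (cycles σ): list the leaders and read off their colours.
module Colourings {n : ℕ} (σ : Fun n) (perm : IsPerm σ) (k : ℕ) where
  open Cycles σ perm

  leaders : List (Fin n)
  leaders = filter (isLeader? σ) (allFin n)

  leaderAt : Fin (cycles σ) → Fin n
  leaderAt = Data.List.lookup leaders

  leaders-unique : Unique leaders
  leaders-unique = Unique.filter⁺ (isLeader? σ) (Unique.allFin⁺ n)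

  leaderOf∈leaders : ∀ i → leaderOf i ∈ leaders
  leaderOf∈leaders i = ∈-filter⁺ (isLeader? σ) (∈-allFin (leaderOf i)) (leaderOf-isLeader i)

  cycleIndex : Fin n → Fin (cycles σ)
  cycleIndex i = Any.index (leaderOf∈leaders i)

  lookup-cycleIndex : ∀ i → leaderAt (cycleIndex i) ≡ leaderOf i
  lookup-cycleIndex i = sym (AnyP.lookup-index (leaderOf∈leaders i))

  cycleIndex-lookup : ∀ j → cycleIndex (leaderAt j) ≡ j
  cycleIndex-lookup j = index-unique leaders-unique (leaderOf∈leaders xⱼ) j (leaderOf-leader xⱼ-leads)
    where
    xⱼ = leaderAt j
    xⱼ-leads : IsLeader σ xⱼ
    xⱼ-leads = proj₂ (∈-filter⁻ (isLeader? σ) {xs = allFin n} (∈-lookup j))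

  readOff : Vec (Fin k) n → Vec (Fin k) (cycles σ)
  readOff c = Vec.map (lookup c) (fromList leaders)

  spread : Vec (Fin k) (cycles σ) → Vec (Fin k) n
  spread d = tabulate (lookup d ∘ cycleIndex)

  lookup-readOff : ∀ c j → lookup (readOff c) j ≡ lookup c (leaderAt j)
  lookup-readOff c j =
    trans (VecP.lookup-map j (lookup c) (fromList leaders)) (cong (lookup c) (lookup-fromList leaders j))

  readOff-spread : ∀ d → readOff (spread d) ≡ d
  readOff-spread d = vec-ext λ j → begin
    lookup (readOff (spread d)) j      ≡⟨ lookup-readOff (spread d) j ⟩
    lookup (spread d) (leaderAt j)     ≡⟨ VecP.lookup∘tabulate _ (leaderAt j) ⟩
    lookup d (cycleIndex (leaderAt j)) ≡⟨ cong (lookup d) (cycleIndex-lookup j) ⟩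
    lookup d j                         ∎
    where open ≡-Reasoning

  spread-readOff : ∀ c → ConstOnCycles σ c → spread (readOff c) ≡ c
  spread-readOff c c-const = vec-ext λ i → begin
    lookup (spread (readOff c)) i      ≡⟨ VecP.lookup∘tabulate _ i ⟩
    lookup (readOff c) (cycleIndex i)  ≡⟨ lookup-readOff c (cycleIndex i) ⟩
    lookup c (leaderAt (cycleIndex i)) ≡⟨ cong (lookup c) (lookup-cycleIndex i) ⟩
    lookup c (leaderOf i)              ≡⟨ c-const (leaderOf i) i (leaderOf-sameCycle i) ⟩
    lookup c i                         ∎
    where open ≡-Reasoning

  spread-const : ∀ d → ConstOnCycles σ (spread d)
  spread-const d i j i~j = begin
    lookup (spread d) i             ≡⟨ VecP.lookup∘tabulate _ i ⟩
    lookup d (cycleIndex i)         ≡⟨ cong (lookup d) cycleIndex-cong ⟩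
    lookup d (cycleIndex j)         ≡⟨ sym (VecP.lookup∘tabulate _ j) ⟩
    lookup (spread d) j             ∎
    where
    open ≡-Reasoning
    cycleIndex-cong : cycleIndex i ≡ cycleIndex j
    cycleIndex-cong = index-unique leaders-unique (leaderOf∈leaders i) (cycleIndex j)
      (trans (leaderOf-cong i~j) (sym (lookup-cycleIndex j)))

  cyclesOfColour-readOff : ∀ c a → cyclesOfColour σ c a ≡ occurrences a (readOff c)
  cyclesOfColour-readOff c a = begin
    cyclesOfColour σ c a
      ≡⟨ count-×-dec (isLeader? σ) (λ i → lookup c i FinP.≟ a) (allFin n) ⟩
    count (λ i → lookup c i FinP.≟ a) leaders
      ≡⟨ sym (count-map (FinP._≟ a) (lookup c) leaders) ⟩
    count (FinP._≟ a) (map (lookup c) leaders)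
      ≡⟨ cong (count (FinP._≟ a) ∘ map (lookup c)) (sym (VecP.toList∘fromList leaders)) ⟩
    count (FinP._≟ a) (map (lookup c) (Vec.toList (fromList leaders)))
      ≡⟨ cong (count (FinP._≟ a)) (sym (VecP.toList-map (lookup c) (fromList leaders))) ⟩
    occurrences a (readOff c) ∎
    where open ≡-Reasoning

  admissibleColourings : ∀ t →
    count (λ c → constOnCycles? σ c ×-dec colourOK? t σ c) (allVecs n k)
      ≡ withContent (cycles σ) (required t)
  admissibleColourings t = count-bijection _ (hasContent? (required t)) readOff spread
    (allVecs n k) (allVecs (cycles σ) k) (allVecs-unique n k) (allVecs-unique (cycles σ) k)
    (λ {c} _ (c-const , c-ok) →
      allVecs-complete (readOff c) ,
      (λ a → trans (sym (cyclesOfColour-readOff c a)) (c-ok a)) ,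
      spread-readOff c c-const)
    (λ {d} _ d-ok →
      allVecs-complete (spread d) ,
      (spread-const d , λ a → trans (cyclesOfColour-readOff (spread d) a)
                                    (trans (cong (occurrences a) (readOff-spread d)) (d-ok a))) ,
      readOff-spread d)

colouringsOf : ∀ {n} k t r (σ : Fun n) → ℕ
colouringsOf {n} k t r σ =
  count (λ c → isPerm? σ ×-dec (rSeparated? r σ ×-dec (constOnCycles? σ c ×-dec colourOK? t σ c)))
        (allVecs n (suc k))

colouringsOf-separated : ∀ {n} k t r (σ : Fun n) → IsPerm σ → RSeparated r σ →
  colouringsOf k t r σ ≡ arrangements (cycles σ) t k
colouringsOf-separated {n} k t r σ perm sep = begin
  colouringsOf k t r σ
    ≡⟨ count-≐ _ _ (proj₂ ∘ proj₂) (λ ok → perm , sep , ok) (allVecs n (suc k)) ⟩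
  count (λ c → constOnCycles? σ c ×-dec colourOK? t σ c) (allVecs n (suc k))
    ≡⟨ admissibleColourings t ⟩
  withContent (cycles σ) (required t)
    ≡⟨ withContent-arrangements (cycles σ) (required t) (λ _ → ≤-refl) ⟩
  arrangements (cycles σ) t (∑[ y < k ] 1)
    ≡⟨ cong (arrangements (cycles σ) t) (sum-ones k) ⟩
  arrangements (cycles σ) t k ∎
  where
  open ≡-Reasoning
  open Colourings σ perm (suc k)

colouringsOf-counted : ∀ {n} k t r (σ : Fun n) → IsPerm σ × RSeparated r σ × cycles σ ≡ t + k →
  colouringsOf k t r σ ≡ fall (t + k) k
colouringsOf-counted k t r σ (perm , sep , cycles≡t+k) = begin
  colouringsOf k t r σ        ≡⟨ colouringsOf-separated k t r σ perm sep ⟩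
  arrangements (cycles σ) t k ≡⟨ arrangements-closed (cycles σ) t k cycles≡t+k ⟩
  fall (cycles σ) k           ≡⟨ cong (λ m → fall m k) cycles≡t+k ⟩
  fall (t + k) k              ∎
  where open ≡-Reasoning

colouringsOf-uncounted : ∀ {n} k t r (σ : Fun n) → ¬ (IsPerm σ × RSeparated r σ × cycles σ ≡ t + k) →
  colouringsOf k t r σ ≡ 0
colouringsOf-uncounted {n} k t r σ ¬counted = byCases (isPerm? σ) (rSeparated? r σ)
  where
  byCases : Dec (IsPerm σ) → Dec (RSeparated r σ) → colouringsOf k t r σ ≡ 0
  byCases (no ¬perm) _         = count-none _ (λ _ → ¬perm ∘ proj₁) (allVecs n (suc k))
  byCases (yes _)    (no ¬sep) = count-none _ (λ _ → ¬sep ∘ proj₁ ∘ proj₂) (allVecs n (suc k))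
  byCases (yes perm) (yes sep) = trans (colouringsOf-separated k t r σ perm sep)
    (arrangements-other (cycles σ) t k λ cycles≡t+k → ¬counted (perm , sep , cycles≡t+k))

mainTheorem18 : (n k t r : ℕ) → 0 < n → 0 < k → 0 < t → 0 < r →
    rMixed n k t r ≡ fall (t + k ∸ 1) (k ∸ 1) * rStirling1 n (t + k ∸ 1) r
mainTheorem18 n (suc k′) t r _ _ _ _ =
  count-pairs admissible? stirling? (fall M k′) (allVecs n (suc k′)) counted others (allVecs n n)
  where
  M = t + suc k′ ∸ 1
  M≡t+k′ : M ≡ t + k′
  M≡t+k′ = cong (_∸ 1) (+-suc t k′)

  Admissible : Fun n × Vec (Fin (suc k′)) n → Set
  Admissible (σ , c) = IsPerm σ × RSeparated r σ × ConstOnCycles σ c × ColourOK t σ c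
  admissible? : Decidable Admissible
  admissible? (σ , c) = isPerm? σ ×-dec (rSeparated? r σ ×-dec (constOnCycles? σ c ×-dec colourOK? t σ c))

  Stirling : Fun n → Set
  Stirling σ = IsPerm σ × RSeparated r σ × cycles σ ≡ M
  stirling? : Decidable Stirling
  stirling? σ = isPerm? σ ×-dec (rSeparated? r σ ×-dec (cycles σ Data.Nat.≟ M))

  counted : ∀ σ → Stirling σ → colouringsOf k′ t r σ ≡ fall M k′
  counted σ (perm , sep , cycles≡M) =
    trans (colouringsOf-counted k′ t r σ (perm , sep , trans cycles≡M M≡t+k′))
          (cong (λ m → fall m k′) (sym M≡t+k′))

  others : ∀ σ → ¬ Stirling σ → colouringsOf k′ t r σ ≡ 0
  others σ ¬stirling = colouringsOf-uncounted k′ t r σ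
    λ (perm , sep , cycles≡t+k′) → ¬stirling (perm , sep , trans cycles≡t+k′ (sym M≡t+k′))
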